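{- Let $\mathcal{C} = (\mathfrak{G}, \to)$ be a combinatory logic system all of whose basic combinators are hierarchical. Then $\mathcal{C}$ is locally finite, and any two $\mathfrak{G}$-terms lying in the same connected component of the rewrite graph of $\mathcal{C}$ have the same height.
   Context: An alphabet is a finite set $\mathfrak{G}$ whose elements are called basic combinators. Variables are the symbols $\mathsf{x}_1, \mathsf{x}_2, \dots$, and $\mathbb{X}_n = \{\mathsf{x}_1, \dots, \mathsf{x}_n\}$. The set of $\mathfrak{G}$-terms is the smallest set containing all variables, all basic combinators, and $(\mathfrak{t}_1 \mathfrak{t}_2)$ for any $\mathfrak{G}$-terms $\mathfrak{t}_1, \mathfrak{t}_2$; terms are planar rooted binary trees whose internal nodes are applications and whose leaves are labeled by variables or basic combinators (application associates to the left). The depth of a node $u$ of a term is the number of internal nodes on the path from the root to $u$; the height of a term is the maximal depth among its nodes. For a term $\mathfrak{t}$ and terms $\mathfrak{s}_1,\dots,\mathfrak{s}_n$, $\mathfrak{t}[\mathfrak{s}_1,\dots,\mathfrak{s}_n]$ denotes simultaneous substitution of $\mathfrak{s}_i$ for $\mathsf{x}_i$. A combinatory logic system is a pair $(\mathfrak{G}, \to)$ where for each ${\rm C} \in \mathfrak{G}$ there is exactly one rule ${\rm C}\,\mathsf{x}_1 \cdots \mathsf{x}_n \to \mathfrak{t}_{\rm C}$ with $n\ge 1$ (the order of ${\rm C}$) and $\mathfrak{t}_{\rm C}$ a term with no basic combinator and variables in $\mathbb{X}_n$. Its context closure $\Rightarrow$ is the smallest relation with ${\rm C}\,\mathsf{x}_1\cdots\mathsf{x}_n[\mathfrak{s}_1,\dots,\mathfrak{s}_n]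 \Rightarrow \mathfrak{t}_{\rm C}[\mathfrak{s}_1,\dots,\mathfrak{s}_n]$ for all terms $\mathfrak{s}_i$, closed under $\mathfrak{t}_1 \Rightarrow \mathfrak{t}_1'$ implies $\mathfrak{t}_1\mathfrak{t}_2 \Rightarrow \mathfrak{t}_1'\mathfrak{t}_2$ and $\mathfrak{t}_2\mathfrak{t}_1 \Rightarrow \mathfrak{t}_2\mathfrak{t}_1'$. The rewrite graph of $\mathcal{C}$ is the directed graph on $\mathfrak{G}$-terms with an arc $\mathfrak{t}\to\mathfrak{t}'$ whenever $\mathfrak{t} \Rightarrow \mathfrak{t}'$ (connected components are taken ignoring arc directions). Let $\equiv$ be the reflexive, symmetric and transitive closure of $\Rightarrow$; $\mathcal{C}$ is locally finite if every $\equiv$-equivalence class is finite. A basic combinator ${\rm C}$ of order $n$ is hierarchical if for every $i \in \{1,\dots,n\}$, the variable $\mathsf{x}_i$ appears in $\mathfrak{t}_{\rm C}$ at depth $n+1-i$ (e.g. $\mathsf{x}_1\mathsf{x}_1$, $\mathsf{x}_2(\mathsf{x}_1\mathsf{x}_1)$, $\mathsf{x}_3(\mathsf{x}_1\mathsf{x}_1\mathsf{x}_2)$). -}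

module Defs where

open import Data.Nat using (ℕ; zero; suc; _≤_; _∸_; _⊔_)
open import Data.Fin using (Fin; toℕ)
open import Data.Vec using (Vec; []; _∷_; lookup)
open import Data.List using (List)
open import Data.List.Membership.Propositional using (_∈_)
open import Data.Product using (Σ; ∃; _×_)
open import Relation.Binary.PropositionalEquality using (_≡_)
open import Relation.Binary.Construct.Closure.Equivalence using (EqClosure)

infixl 9 _·_ _·ᵖ_

-- G-terms over an alphabet G = Fin k of k basic combinators.
-- Variables x₁, x₂, … are represented as var 0, var 1, … (0-based).
data Term (k : ℕ) : Set where
  var : ℕ → Term k
  com : Fin k → Term k
  _·_ : Term k → Term k → Term k

-- Right-hand sides of rules: terms with no basic combinator and
-- variables in X_n (x_{i+1} represented as pvar i, i : Fin n).
data Pat (n : ℕ) : Set where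
  pvar : Fin n → Pat n
  _·ᵖ_ : Pat n → Pat n → Pat n

height : ∀ {k} → Term k → ℕ
height (var _) = 0
height (com _) = 0
height (s · t) = suc (height s ⊔ height t)

data Occ {n : ℕ} : Pat n → Fin n → ℕ → Set where
  here  : ∀ {i} → Occ (pvar i) i 0
  left  : ∀ {p q i d} → Occ p i d → Occ (p ·ᵖ q) i (suc d)
  right : ∀ {p q i d} → Occ q i d → Occ (p ·ᵖ q) i (suc d)

record CLSystem (k : ℕ) : Set where
  field
    order    : Fin k → ℕ
    order≥1  : ∀ c → 1 ≤ order c
    rhs      : (c : Fin k) → Pat (order c)
open CLSystem public

subst : ∀ {k n} → Pat n → Vec (Term k) n → Term k
subst (pvar i) σ = lookup σ i
subst (p ·ᵖ q) σ = subst p σ · subst q σ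

applyAll : ∀ {k n} → Term k → Vec (Term k) n → Term k
applyAll t [] = t
applyAll t (s ∷ ss) = applyAll (t · s) ss

data _⇒⟨_⟩_ {k : ℕ} : Term k → CLSystem k → Term k → Set where
  rule  : ∀ {𝒞} (c : Fin k) (σ : Vec (Term k) (order 𝒞 c)) →
          applyAll (com c) σ ⇒⟨ 𝒞 ⟩ subst (rhs 𝒞 c) σ
  appˡ  : ∀ {𝒞 t₁ t₁′} t₂ → t₁ ⇒⟨ 𝒞 ⟩ t₁′ → (t₁ · t₂) ⇒⟨ 𝒞 ⟩ (t₁′ · t₂)
  appʳ  : ∀ {𝒞 t₁ t₁′} t₂ → t₁ ⇒⟨ 𝒞 ⟩ t₁′ → (t₂ · t₁) ⇒⟨ 𝒞 ⟩ (t₂ · t₁′)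

_≡⟨_⟩_ : ∀ {k} → Term k → CLSystem k → Term k → Set
s ≡⟨ 𝒞 ⟩ t = EqClosure (λ a b → a ⇒⟨ 𝒞 ⟩ b) s t

-- Same connected component of the rewrite graph (arcs t → t' iff t ⇒ t',
-- directions ignored): an undirected path, i.e. the equivalence closure.
SameComponent : ∀ {k} → CLSystem k → Term k → Term k → Set
SameComponent 𝒞 s t = EqClosure (λ a b → a ⇒⟨ 𝒞 ⟩ b) s t

LocallyFinite : ∀ {k} → CLSystem k → Set
LocallyFinite {k} 𝒞 =
  (t : Term k) → Σ (List (Term k)) λ L → ∀ s → t ≡⟨ 𝒞 ⟩ s → s ∈ L

-- C of order n is hierarchical: each x_{i+1} (i : Fin n) appears in t_C,
-- and every occurrence is at depth n+1-(i+1) = n ∸ toℕ i.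
Hierarchical : ∀ {k} → CLSystem k → Fin k → Set
Hierarchical 𝒞 c =
  ∀ (i : Fin (order 𝒞 c)) →
    (∃ λ d → Occ (rhs 𝒞 c) i d) ×
    (∀ d → Occ (rhs 𝒞 c) i d → d ≡ order 𝒞 c ∸ toℕ i)

-- A hierarchical rule C x₁ ⋯ xₙ → t_C puts xᵢ at depth n + 1 − i on both
-- sides, so the height of a redex instance and of its contractum is the same
-- maximum of (depth of xᵢ) + (height of the i-th argument); hence every rewrite
-- step preserves height. Each side of a rule also contains exactly the
-- variables x₁, …, xₙ, so a step preserves the set of term variables. An
-- equivalence class therefore consists of terms of one fixed height over one
-- fixed finite set of variables and the finite alphabet, of which there are
-- finitely many.
module Submission where

open import Defs hiding (_≡⟨_⟩_)
open import Data.Nat using (ℕ; zero; suc; _+_; _≤_; _∸_; _⊔_; s≤s)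
open import Data.Nat.Properties
open import Data.Fin using (Fin; toℕ) renaming (zero to fzero; suc to fsuc)
open import Data.Vec using (Vec; []; _∷_; lookup)
open import Data.List using (List; []; _∷_; _++_; map; cartesianProductWith; allFin)
open import Data.List.Membership.Propositional using (_∈_)
open import Data.List.Membership.Propositional.Properties
  using (∈-++⁺ˡ; ∈-++⁺ʳ; ∈-map⁺; ∈-allFin; ∈-cartesianProductWith⁺)
import Data.List.Relation.Unary.Any as Any
open import Data.Product using (_×_; _,_; ∃; proj₁; proj₂)
open import Data.Sum using (_⊎_; inj₁; inj₂)
open import Function using (_∘_; _⇔_; mk⇔; Equivalence)
open import Function.Properties.Equivalence using (⇔-isEquivalence)
open import Relation.Binary.PropositionalEquality
  using (_≡_; refl; sym; cong; isEquivalence) renaming (subst to ≡-subst)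
open import Relation.Binary.Construct.Closure.Equivalence using (gfold)

private
  variable
    k n m v : ℕ

suc[m⊔n]+o≤k : ∀ m n o k → m + suc o ≤ k → n + suc o ≤ k → suc (m ⊔ n) + o ≤ k
suc[m⊔n]+o≤k m n o k m≤ n≤
  rewrite sym (+-suc (m ⊔ n) o) | +-distribʳ-⊔ (suc o) m n = ⊔-lub m≤ n≤

height-subst-≥ : ∀ {p : Pat n} (σ : Vec (Term k) n) {i d} → Occ p i d →
                 d + height (lookup σ i) ≤ height (subst p σ)
height-subst-≥ σ here      = ≤-refl
height-subst-≥ σ (left o)  = s≤s (≤-trans (height-subst-≥ σ o) (m≤m⊔n _ _))
height-subst-≥ σ (right o) = s≤s (≤-trans (height-subst-≥ σ o) (m≤n⊔m _ _))

height-subst-≤ : ∀ (p : Pat n) (σ : Vec (Term k) n) M →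
                 (∀ i d → Occ p i d → d + height (lookup σ i) ≤ M) →
                 height (subst p σ) ≤ M
height-subst-≤ p σ M bound = ≡-subst (_≤ M) (+-identityʳ _)
  (go p 0 λ i d o → ≡-subst (_≤ M) (sym (+-identityʳ _)) (bound i d o))
  where
  go : ∀ p e → (∀ i d → Occ p i d → d + height (lookup σ i) + e ≤ M) →
       height (subst p σ) + e ≤ M
  go (pvar i) e b = b i 0 here
  go (p ·ᵖ q) e b = suc[m⊔n]+o≤k _ _ e M (go p (suc e) (shift left)) (go q (suc e) (shift right))
    where
    shift : ∀ {r} → (∀ {i d} → Occ r i d → Occ (p ·ᵖ q) i (suc d)) →
            ∀ i d → Occ r i d → d + height (lookup σ i) + suc e ≤ M
    shift into i d o = ≡-subst (_≤ M) (sym (+-suc _ e)) (b i (suc d) (into o))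

height-applyAll-≥ : ∀ (u : Term k) (σ : Vec (Term k) n) →
                    height u + n ≤ height (applyAll u σ)
height-applyAll-≥ u [] = ≤-reflexive (+-identityʳ _)
height-applyAll-≥ u (s ∷ σ) = begin
  height u + suc _        ≡⟨ +-suc (height u) _ ⟩
  suc (height u + _)      ≤⟨ s≤s (+-monoˡ-≤ _ (m≤m⊔n (height u) (height s))) ⟩
  height (u · s) + _      ≤⟨ height-applyAll-≥ (u · s) σ ⟩
  height (applyAll (u · s) σ) ∎
  where open ≤-Reasoning

height-applyAll-≥-arg : ∀ (u : Term k) (σ : Vec (Term k) n) (i : Fin n) →
                        n ∸ toℕ i + height (lookup σ i) ≤ height (applyAll u σ)
height-applyAll-≥-arg u (s ∷ σ) fzero = begin
  suc (_ + height s)      ≡⟨ cong suc (+-comm _ (height s)) ⟩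
  suc (height s + _)      ≤⟨ s≤s (+-monoˡ-≤ _ (m≤n⊔m (height u) (height s))) ⟩
  height (u · s) + _      ≤⟨ height-applyAll-≥ (u · s) σ ⟩
  height (applyAll (u · s) σ) ∎
  where open ≤-Reasoning
height-applyAll-≥-arg u (s ∷ σ) (fsuc i) = height-applyAll-≥-arg (u · s) σ i

height-applyAll-≤ : ∀ (u : Term k) (σ : Vec (Term k) n) M → height u + n ≤ M →
                    (∀ i → n ∸ toℕ i + height (lookup σ i) ≤ M) →
                    height (applyAll u σ) ≤ M
height-applyAll-≤ u [] M u≤ _ = ≡-subst (_≤ M) (+-identityʳ _) u≤
height-applyAll-≤ u (s ∷ σ) M u≤ args≤ =
  height-applyAll-≤ (u · s) σ M
    (suc[m⊔n]+o≤k _ _ _ M u≤ (≡-subst (_≤ M) (+-comm (suc _) (height s)) (args≤ fzero)))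
    (args≤ ∘ fsuc)

n≤-of-first-bound : ∀ {M} (f : Fin n → ℕ) → 1 ≤ n →
                    (∀ i → n ∸ toℕ i + f i ≤ M) → n ≤ M
n≤-of-first-bound f (s≤s _) bound = ≤-trans (m≤m+n _ (f fzero)) (bound fzero)

module _ {𝒞 : CLSystem k} where

  height-rule : ∀ c → Hierarchical 𝒞 c → (σ : Vec (Term k) (order 𝒞 c)) →
                height (applyAll (com c) σ) ≡ height (subst (rhs 𝒞 c) σ)
  height-rule c hier σ = ≤-antisym
    (height-applyAll-≤ (com c) σ _
      (n≤-of-first-bound (height ∘ lookup σ) (order≥1 𝒞 c) arg≤rhs) arg≤rhs)
    (height-subst-≤ (rhs 𝒞 c) σ _ λ i d o →
      ≡-subst (λ e → e + height (lookup σ i) ≤ _) (sym (proj₂ (hier i) d o))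
              (height-applyAll-≥-arg (com c) σ i))
    where
    arg≤rhs : ∀ i → order 𝒞 c ∸ toℕ i + height (lookup σ i) ≤ height (subst (rhs 𝒞 c) σ)
    arg≤rhs i with hier i
    ... | (d , o) , depth = ≡-subst (λ e → e + height (lookup σ i) ≤ _) (depth d o)
                                    (height-subst-≥ σ o)

  height-⇒ : (∀ c → Hierarchical 𝒞 c) → ∀ {s t} → s ⇒⟨ 𝒞 ⟩ t → height s ≡ height t
  height-⇒ hier (rule c σ)  = height-rule c (hier c) σ
  height-⇒ hier (appˡ u r)  = cong (λ h → suc (h ⊔ height u)) (height-⇒ hier r)
  height-⇒ hier (appʳ u r)  = cong (λ h → suc (height u ⊔ h)) (height-⇒ hier r)

  height-component : (∀ c → Hierarchical 𝒞 c) →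
                     ∀ {s t} → SameComponent 𝒞 s t → height s ≡ height t
  height-component hier = gfold isEquivalence height (height-⇒ hier)

infix 4 _∈ᵛ_

data _∈ᵛ_ {k : ℕ} (v : ℕ) : Term k → Set where
  here  : v ∈ᵛ var v
  left  : ∀ {a b} → v ∈ᵛ a → v ∈ᵛ a · b
  right : ∀ {a b} → v ∈ᵛ b → v ∈ᵛ a · b

∈ᵛ-subst⁺ : ∀ {p : Pat n} (σ : Vec (Term k) n) {i d} → Occ p i d →
            v ∈ᵛ lookup σ i → v ∈ᵛ subst p σ
∈ᵛ-subst⁺ σ here      x = x
∈ᵛ-subst⁺ σ (left o)  x = left (∈ᵛ-subst⁺ σ o x)
∈ᵛ-subst⁺ σ (right o) x = right (∈ᵛ-subst⁺ σ o x)

∈ᵛ-subst⁻ : ∀ (p : Pat n) (σ : Vec (Term k) n) →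
            v ∈ᵛ subst p σ → ∃ λ i → v ∈ᵛ lookup σ i
∈ᵛ-subst⁻ (pvar i) σ x         = i , x
∈ᵛ-subst⁻ (p ·ᵖ q) σ (left x)  = ∈ᵛ-subst⁻ p σ x
∈ᵛ-subst⁻ (p ·ᵖ q) σ (right x) = ∈ᵛ-subst⁻ q σ x

∈ᵛ-applyAll⁺ˡ : ∀ (u : Term k) (σ : Vec (Term k) m) → v ∈ᵛ u → v ∈ᵛ applyAll u σ
∈ᵛ-applyAll⁺ˡ u []      x = x
∈ᵛ-applyAll⁺ˡ u (s ∷ σ) x = ∈ᵛ-applyAll⁺ˡ (u · s) σ (left x)

∈ᵛ-applyAll⁺ʳ : ∀ (u : Term k) (σ : Vec (Term k) n) i →
                v ∈ᵛ lookup σ i → v ∈ᵛ applyAll u σ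
∈ᵛ-applyAll⁺ʳ u (s ∷ σ) fzero    x = ∈ᵛ-applyAll⁺ˡ (u · s) σ (right x)
∈ᵛ-applyAll⁺ʳ u (s ∷ σ) (fsuc i) x = ∈ᵛ-applyAll⁺ʳ (u · s) σ i x

∈ᵛ-applyAll⁻ : ∀ (u : Term k) (σ : Vec (Term k) m) → v ∈ᵛ applyAll u σ →
               v ∈ᵛ u ⊎ ∃ λ i → v ∈ᵛ lookup σ i
∈ᵛ-applyAll⁻ u [] x = inj₁ x
∈ᵛ-applyAll⁻ u (s ∷ σ) x with ∈ᵛ-applyAll⁻ (u · s) σ x
... | inj₁ (left y)  = inj₁ y
... | inj₁ (right y) = inj₂ (fzero , y)
... | inj₂ (i , y)   = inj₂ (fsuc i , y)

NonErasing : CLSystem k → Fin k → Set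
NonErasing 𝒞 c = ∀ i → ∃ λ d → Occ (rhs 𝒞 c) i d

Hierarchical⇒NonErasing : (𝒞 : CLSystem k) (c : Fin k) → Hierarchical 𝒞 c → NonErasing 𝒞 c
Hierarchical⇒NonErasing 𝒞 c hier = proj₁ ∘ hier

module _ {𝒞 : CLSystem k} where

  ∈ᵛ-⇒⁻ : ∀ {s t} → s ⇒⟨ 𝒞 ⟩ t → v ∈ᵛ t → v ∈ᵛ s
  ∈ᵛ-⇒⁻ (rule c σ) x with ∈ᵛ-subst⁻ (rhs 𝒞 c) σ x
  ... | i , y = ∈ᵛ-applyAll⁺ʳ (com c) σ i y
  ∈ᵛ-⇒⁻ (appˡ u r) (left x)  = left (∈ᵛ-⇒⁻ r x)
  ∈ᵛ-⇒⁻ (appˡ u r) (right x) = right x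
  ∈ᵛ-⇒⁻ (appʳ u r) (left x)  = left x
  ∈ᵛ-⇒⁻ (appʳ u r) (right x) = right (∈ᵛ-⇒⁻ r x)

  ∈ᵛ-⇒⁺ : (∀ c → NonErasing 𝒞 c) → ∀ {s t} → s ⇒⟨ 𝒞 ⟩ t → v ∈ᵛ s → v ∈ᵛ t
  ∈ᵛ-⇒⁺ nonErasing (rule c σ) x with ∈ᵛ-applyAll⁻ (com c) σ x
  ... | inj₁ ()
  ... | inj₂ (i , y) = ∈ᵛ-subst⁺ σ (proj₂ (nonErasing c i)) y
  ∈ᵛ-⇒⁺ nonErasing (appˡ u r) (left x)  = left (∈ᵛ-⇒⁺ nonErasing r x)
  ∈ᵛ-⇒⁺ nonErasing (appˡ u r) (right x) = right x
  ∈ᵛ-⇒⁺ nonErasing (appʳ u r) (left x)  = left x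
  ∈ᵛ-⇒⁺ nonErasing (appʳ u r) (right x) = right (∈ᵛ-⇒⁺ nonErasing r x)

  ∈ᵛ-component : (∀ c → NonErasing 𝒞 c) →
                 ∀ {v s t} → SameComponent 𝒞 s t → v ∈ᵛ s ⇔ v ∈ᵛ t
  ∈ᵛ-component nonErasing {v} =
    gfold ⇔-isEquivalence (v ∈ᵛ_) λ r → mk⇔ (∈ᵛ-⇒⁺ nonErasing r) (∈ᵛ-⇒⁻ r)

module _ {k : ℕ} where

  vars : Term k → List ℕ
  vars (var v) = v ∷ []
  vars (com _) = []
  vars (a · b) = vars a ++ vars b

  ∈ᵛ⇒∈vars : ∀ {v t} → v ∈ᵛ t → v ∈ vars t
  ∈ᵛ⇒∈vars here               = Any.here refl
  ∈ᵛ⇒∈vars (left x)           = ∈-++⁺ˡ (∈ᵛ⇒∈vars x)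
  ∈ᵛ⇒∈vars (right {a = a} x)  = ∈-++⁺ʳ (vars a) (∈ᵛ⇒∈vars x)

  leaves : List ℕ → List (Term k)
  leaves vs = map var vs ++ map com (allFin k)

  termsOfHeight≤ : List ℕ → ℕ → List (Term k)
  termsOfHeight≤ vs zero    = leaves vs
  termsOfHeight≤ vs (suc h) =
    leaves vs ++ cartesianProductWith _·_ (termsOfHeight≤ vs h) (termsOfHeight≤ vs h)

  ∈-termsOfHeight≤ : ∀ vs h t → height t ≤ h → (∀ {v} → v ∈ᵛ t → v ∈ vs) →
                     t ∈ termsOfHeight≤ vs h
  ∈-termsOfHeight≤ vs h (var v) _ vars⊆ = leaf∈ h (∈-++⁺ˡ (∈-map⁺ var (vars⊆ here)))
    where
    leaf∈ : ∀ h {t} → t ∈ leaves vs → t ∈ termsOfHeight≤ vs h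
    leaf∈ zero    = λ x → x
    leaf∈ (suc h) = ∈-++⁺ˡ
  ∈-termsOfHeight≤ vs zero    (com c) _ _ = ∈-++⁺ʳ (map var vs) (∈-map⁺ com (∈-allFin c))
  ∈-termsOfHeight≤ vs (suc h) (com c) _ _ =
    ∈-++⁺ˡ (∈-++⁺ʳ (map var vs) (∈-map⁺ com (∈-allFin c)))
  ∈-termsOfHeight≤ vs (suc h) (a · b) (s≤s a⊔b≤h) vars⊆ =
    ∈-++⁺ʳ (leaves vs) (∈-cartesianProductWith⁺ _·_
      (∈-termsOfHeight≤ vs h a (≤-trans (m≤m⊔n _ _) a⊔b≤h) (vars⊆ ∘ left))
      (∈-termsOfHeight≤ vs h b (≤-trans (m≤n⊔m _ _) a⊔b≤h) (vars⊆ ∘ right)))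

proposition1p2 : (k : ℕ) (𝒞 : CLSystem k) → (∀ c → Hierarchical 𝒞 c) →
    LocallyFinite 𝒞 ×
    (∀ s t → SameComponent 𝒞 s t → height s ≡ height t)
proposition1p2 k 𝒞 hier = locallyFinite , λ _ _ → height-component hier
  where
  nonErasing : ∀ c → NonErasing 𝒞 c
  nonErasing c = Hierarchical⇒NonErasing 𝒞 c (hier c)

  locallyFinite : LocallyFinite 𝒞
  locallyFinite t = termsOfHeight≤ (vars t) (height t) , λ s t≡s →
    ∈-termsOfHeight≤ (vars t) (height t) s
      (≤-reflexive (sym (height-component hier t≡s)))
      (∈ᵛ⇒∈vars ∘ Equivalence.from (∈ᵛ-component nonErasing t≡s))
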